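{- Let $f^k_{k,n}$ and $l^i_{k,n}$ ($1\le i\le k$, $n\in\mathbb{Z}$) be as in the context. Then: (i) For $k\ge 3$, $1\le i\le k$ and $n\ge 0$, $$l^i_{k,n}=\sum_{j=1}^{k+i-1} d_j\, f^k_{k,n-j},\qquad d_j=\begin{cases}\frac{j(j+1)}{2} & \text{if } 1\le j\le i,\\ \frac{j(j+1)}{2}-\frac{(j-i)(j-i+1)}{2} & \text{if } i+1\le j\le k-1,\\ \frac{k(k+1)}{2}-\frac{(j-i)(j-i+1)}{2} & \text{if } k\le j\le k+i-1.\end{cases}$$ (ii) For $k\ge 2$, $1\le i\le k$ and $n\ge 0$, $$l^i_{k,n}=\begin{cases} kf^k_{k,n}-\sum_{j=2}^{k}(k-j+1)f^k_{k,n+1-j} & \text{if } i=1,\\ \sum_{m=1}^{i}kf^k_{k,n-m+1}-\sum_{m=1}^{i}\sum_{j=2}^{k}(k-j+1)f^k_{k,n-m-j+2} & \text{if } 1<i<k,\\ kf^k_{k,n+1}-\sum_{j=2}^{k}(k-j+1)f^k_{k,n+2-j} & \text{if } i=k.\end{cases}$$ (iii) For $k\ge 2$, $1\le i\le k$ and $n\ge 0$, $$l^i_{k,n}=\begin{cases} \sum_{j=1}^{k} j f^k_{k,n-j} & \text{if } i=1,\\ \sum_{m=1}^{i}\sum_{j=1}^{k} j f^k_{k,n-m-j+1} & \text{if } 1<i<k,\\ \sum_{j=1}^{k} jf^k_{k,n+1-j} & \text{if } i=k.\end{cases}$$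
   Context: $k$ sequences of generalized order-$k$ Fibonacci numbers: for $1\le i\le k$, $f^i_{k,n}=1$ if $1-k\le n\le 0$ and $i=1-n$, $f^i_{k,n}=0$ if $1-k\le n\le 0$ and $i\neq 1-n$, and $f^i_{k,n}=\sum_{j=1}^k f^i_{k,n-j}$ for $n\ge 1$. $k$ sequences of generalized order-$k$ Lucas numbers: for $1\le i\le k$ and $1-k\le n\le 0$, $l^i_{k,n}=-i$ if $i-n<k$, $l^i_{k,n}=i-2n$ if $i-n=k$, $l^i_{k,n}=k-i-1$ if $i-n>k$; and $l^i_{k,n}=\sum_{j=1}^k l^i_{k,n-j}$ for $n\ge 1$. All these sequences are extended to all integers $n$ by requiring their recurrence $x_n=\sum_{j=1}^k x_{n-j}$ to hold for all $n\in\mathbb{Z}$ (this determines the terms of index $<1-k$ uniquely). -}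

module Defs where

open import Data.Nat as ℕ using (ℕ; zero; suc; _∸_; _≤ᵇ_; _≡ᵇ_)
open import Data.Integer using (ℤ; +_; -[1+_]; _+_; _-_; _*_; -_; 0ℤ)
open import Data.List using (List; []; _∷_; _++_; map; upTo)
open import Data.Bool using (if_then_else_)
open import Function using (_∘_)

sum : List ℤ → ℤ
sum []       = 0ℤ
sum (x ∷ xs) = x + sum xs

iter : {A : Set} → ℕ → (A → A) → A → A
iter zero    g a = a
iter (suc m) g a = g (iter m g a)

-- A "window" of a sequence x satisfying x_n = x_{n-1} + ... + x_{n-k}
-- is the list [x_m , x_{m-1} , ... , x_{m-k+1}] (length k).

dropLast : List ℤ → List ℤ
dropLast []           = []
dropLast (x ∷ [])     = []
dropLast (x ∷ y ∷ ys) = x ∷ dropLast (y ∷ ys)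

-- window at m  ↦  window at m+1   (x_{m+1} = x_m + ... + x_{m-k+1})
stepFwd : List ℤ → List ℤ
stepFwd w = sum w ∷ dropLast w

-- window at m  ↦  window at m-1   (x_{m-k} = x_m - (x_{m-1} + ... + x_{m-k+1}))
stepBwd : List ℤ → List ℤ
stepBwd []       = []
stepBwd (x ∷ xs) = xs ++ (x - sum xs) ∷ []

headZ : List ℤ → ℤ
headZ []      = 0ℤ
headZ (x ∷ _) = x

-- The unique sequence ℤ → ℤ satisfying x_n = Σ_{j=1}^k x_{n-j} for all n ∈ ℤ
-- with initial values x_{1-k}, ..., x_0 given by init:  x_{-t} = init t  (0 ≤ t ≤ k-1).
recSeq : (k : ℕ) → (init : ℕ → ℤ) → ℤ → ℤ
recSeq k init (+ m)     = headZ (iter m stepFwd (map init (upTo k)))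
recSeq k init -[1+ m ]  = headZ (iter (suc m) stepBwd (map init (upTo k)))

-- Initial values of f^i_{k,n} at n = -t (0 ≤ t ≤ k-1): 1 iff i = 1 - n = 1 + t.
fibInit : ℕ → ℕ → ℕ → ℤ
fibInit k i t = if i ≡ᵇ suc t then + 1 else 0ℤ

fib : (k i : ℕ) → ℤ → ℤ
fib k i = recSeq k (fibInit k i)

-- Initial values of l^i_{k,n} at n = -t (0 ≤ t ≤ k-1), so i - n = i + t:
--   -i if i + t < k ;  i - 2n = i + 2t if i + t = k ;  k - i - 1 if i + t > k.
lucInit : ℕ → ℕ → ℕ → ℤ
lucInit k i t =
  if suc (i ℕ.+ t) ≤ᵇ k then - (+ i)
  else if (i ℕ.+ t) ≡ᵇ k then + (i ℕ.+ 2 ℕ.* t)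
  else (+ k - + i) - + 1

lucas : (k i : ℕ) → ℤ → ℤ
lucas k i = recSeq k (lucInit k i)

-- ∑ a b g = Σ_{j=a}^{b} g j  (empty, i.e. 0, if b < a)
∑ : ℕ → ℕ → (ℕ → ℤ) → ℤ
∑ a b g = sum (map (λ t → g (a ℕ.+ t)) (upTo (suc b ∸ a)))

-- triangular numbers tri j = j(j+1)/2
tri : ℕ → ℕ
tri zero    = zero
tri (suc j) = tri j ℕ.+ suc j

dcoef : (k i j : ℕ) → ℤ
dcoef k i j =
  if j ≤ᵇ i then + tri j
  else if j ≤ᵇ k ∸ 1 then + tri j - + tri (j ∸ i)
  else + tri k - + tri (j ∸ i)

module Submission where

-- Every sequence involved solves the order-k recurrence on all of ℤ (Rec k), and such
-- a solution is determined by one window of k consecutive values (Rec-unique).  Each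
-- identity is therefore proved by checking that both sides solve the recurrence --
-- solutions are closed under shifts and ℤ-linear combinations -- and that they agree
-- on the window (x_{1-k}, …, x_0).  Both f^k_k and l^1_k are constant on [2-2k, 0]
-- except at 1-k and -k (Profile), so the windows of the sums in question are
-- computed by sifting against two deltas.

open import Defs
open import Data.Nat using (ℕ; _≤_; _<_; _∸_)
open import Data.Integer using (ℤ; +_; _+_; _-_; _*_)
open import Data.Product using (_×_)
open import Relation.Binary.PropositionalEquality using (_≡_)

open import Data.Nat as ℕ using (zero; suc; z≤n; s≤s; _≤ᵇ_; _≡ᵇ_; _⊓_)
import Data.Nat.Properties as ℕP
open import Data.Integer as ℤ using (-[1+_]; -_; 0ℤ)
import Data.Integer.Properties as ℤP
open import Data.Integer.Tactic.RingSolver using (solve-∀)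
open import Data.List using (List; []; _∷_; _++_; map; upTo; applyUpTo; length)
import Data.List.Properties as ListP
open import Data.Bool using (true; false; if_then_else_; T)
open import Data.Bool.Properties using (T-≡; ¬-not)
open import Data.Empty using (⊥-elim)
open import Data.Product using (_,_)
open import Data.Sum using (_⊎_; inj₁; inj₂; [_,_]′)
open import Function using (_∘_; Equivalence)
open import Relation.Binary.Definitions using (Tri; tri<; tri≈; tri>)
open import Relation.Binary.PropositionalEquality
  using (_≢_; refl; sym; trans; cong; cong₂; subst; module ≡-Reasoning)

S : ℕ → (ℕ → ℤ) → ℤ
S zero    g = 0ℤ
S (suc n) g = S n g + g n

S-cong : ∀ n {g h : ℕ → ℤ} → (∀ t → t < n → g t ≡ h t) → S n g ≡ S n h
S-cong zero    g≡h = refl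
S-cong (suc n) g≡h =
  cong₂ _+_ (S-cong n (λ t t<n → g≡h t (ℕP.m≤n⇒m≤1+n t<n))) (g≡h n ℕP.≤-refl)

S-front : ∀ n g → S (suc n) g ≡ g 0 + S n (g ∘ suc)
S-front zero    g = ℤP.+-comm 0ℤ (g 0)
S-front (suc n) g =
  trans (cong (_+ g (suc n)) (S-front n g)) (ℤP.+-assoc (g 0) (S n (g ∘ suc)) (g (suc n)))

S-+ : ∀ n g h → S n (λ t → g t + h t) ≡ S n g + S n h
S-+ zero    g h = refl
S-+ (suc n) g h = trans (cong (_+ (g n + h n)) (S-+ n g h)) (interchange (S n g) (S n h) (g n) (h n))
  where
  interchange : ∀ a b c d → a + b + (c + d) ≡ a + c + (b + d)
  interchange = solve-∀

S-- : ∀ n g h → S n (λ t → g t - h t) ≡ S n g - S n h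
S-- zero    g h = refl
S-- (suc n) g h = trans (cong (_+ (g n - h n)) (S-- n g h)) (interchange (S n g) (S n h) (g n) (h n))
  where
  interchange : ∀ a b c d → a - b + (c - d) ≡ a + c - (b + d)
  interchange = solve-∀

S-difference : ∀ n g h → S n g ≡ S n h + S n (λ t → g t - h t)
S-difference n g h = trans (sym (add-back (S n g) (S n h))) (cong (λ s → S n h + s) (sym (S-- n g h)))
  where
  add-back : ∀ a b → b + (a - b) ≡ a
  add-back = solve-∀

S-*ˡ : ∀ n c g → S n (λ t → c * g t) ≡ c * S n g
S-*ˡ zero    c g = sym (ℤP.*-zeroʳ c)
S-*ˡ (suc n) c g = trans (cong (_+ c * g n) (S-*ˡ n c g)) (sym (ℤP.*-distribˡ-+ c (S n g) (g n)))

S-*ʳ : ∀ n c g → S n (λ t → g t * c) ≡ S n g * c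
S-*ʳ zero    c g = refl
S-*ʳ (suc n) c g = trans (cong (_+ g n * c) (S-*ʳ n c g)) (sym (ℤP.*-distribʳ-+ c (S n g) (g n)))

S-const : ∀ n c → S n (λ _ → c) ≡ + n * c
S-const zero    c = refl
S-const (suc n) c = trans (cong (_+ c) (S-const n c)) (step (+ n) c)
  where
  step : ∀ m c → m * c + c ≡ (+ 1 + m) * c
  step = solve-∀

S-vanish : ∀ n g → (∀ t → t < n → g t ≡ 0ℤ) → S n g ≡ 0ℤ
S-vanish zero    g g≡0 = refl
S-vanish (suc n) g g≡0 =
  cong₂ _+_ (S-vanish n g (λ t t<n → g≡0 t (ℕP.m≤n⇒m≤1+n t<n))) (g≡0 n ℕP.≤-refl)

S-split : ∀ m n g → S (m ℕ.+ n) g ≡ S m g + S n (λ t → g (m ℕ.+ t))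
S-split m zero    g = trans (cong (λ l → S l g) (ℕP.+-identityʳ m)) (sym (ℤP.+-identityʳ (S m g)))
S-split m (suc n) g = begin
  S (m ℕ.+ suc n) g                                    ≡⟨ cong (λ l → S l g) (ℕP.+-suc m n) ⟩
  S (m ℕ.+ n) g + g (m ℕ.+ n)                          ≡⟨ cong (_+ g (m ℕ.+ n)) (S-split m n g) ⟩
  S m g + S n (λ t → g (m ℕ.+ t)) + g (m ℕ.+ n)         ≡⟨ ℤP.+-assoc (S m g) _ _ ⟩
  S m g + S (suc n) (λ t → g (m ℕ.+ t))                ∎
  where open ≡-Reasoning

S-swap : ∀ m n (g : ℕ → ℕ → ℤ) → S m (λ s → S n (g s)) ≡ S n (λ t → S m (λ s → g s t))
S-swap zero    n g = sym (S-vanish n _ (λ _ _ → refl))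
S-swap (suc m) n g = trans (cong (_+ S n (g m)) (S-swap m n g)) (sym (S-+ n _ (g m)))

S-single : ∀ n g a → a < n → (∀ t → t < n → t ≢ a → g t ≡ 0ℤ) → S n g ≡ g a
S-single (suc n) g a a<1+n vanish with ℕP.m≤n⇒m<n∨m≡n (ℕP.≤-pred a<1+n)
... | inj₁ a<n =
  trans (cong₂ _+_ (S-single n g a a<n (λ t t<n → vanish t (ℕP.m≤n⇒m≤1+n t<n)))
                   (vanish n ℕP.≤-refl (λ n≡a → ℕP.<-irrefl (sym n≡a) a<n)))
        (ℤP.+-identityʳ (g a))
... | inj₂ refl =
  trans (cong (_+ g a) (S-vanish n g (λ t t<n → vanish t (ℕP.m≤n⇒m≤1+n t<n) (λ t≡n → ℕP.<-irrefl t≡n t<n))))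
        (ℤP.+-identityˡ (g a))

sum-applyUpTo : ∀ n (f : ℕ → ℤ) → sum (applyUpTo f n) ≡ S n f
sum-applyUpTo zero    f = refl
sum-applyUpTo (suc n) f = trans (cong (λ s → f 0 + s) (sum-applyUpTo n (f ∘ suc))) (sym (S-front n f))

∑≡S : ∀ a b g → ∑ a b g ≡ S (suc b ∸ a) (λ t → g (a ℕ.+ t))
∑≡S a b g = trans (cong sum (ListP.map-upTo (λ t → g (a ℕ.+ t)) (suc b ∸ a))) (sum-applyUpTo (suc b ∸ a) _)

∑-cong : ∀ a b (g h : ℕ → ℤ) → (∀ t → t < suc b ∸ a → g (a ℕ.+ t) ≡ h (a ℕ.+ t)) → ∑ a b g ≡ ∑ a b h
∑-cong a b g h g≡h = trans (∑≡S a b g) (trans (S-cong (suc b ∸ a) g≡h) (sym (∑≡S a b h)))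

-- Kronecker delta δ p v = [p = v]; "fibInit k k t" is literally δ k (suc t).
δ : ℕ → ℕ → ℤ
δ p v = if p ≡ᵇ v then + 1 else 0ℤ

δ-same : ∀ p → δ p p ≡ + 1
δ-same zero    = refl
δ-same (suc p) = δ-same p

δ-diff : ∀ {p v} → p ≢ v → δ p v ≡ 0ℤ
δ-diff {zero}  {zero}  p≢v = ⊥-elim (p≢v refl)
δ-diff {zero}  {suc v} p≢v = refl
δ-diff {suc p} {zero}  p≢v = refl
δ-diff {suc p} {suc v} p≢v = δ-diff (p≢v ∘ cong suc)

Rec : ℕ → (ℤ → ℤ) → Set
Rec k x = ∀ n → x (n + + 1) ≡ S k (λ t → x (n - + t))

-- Entry t of a list (0 beyond its end); entry 0 is headZ.
nth : List ℤ → ℕ → ℤ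
nth xs       zero    = headZ xs
nth []       (suc t) = 0ℤ
nth (x ∷ xs) (suc t) = nth xs t

sum≡S : ∀ w → sum w ≡ S (length w) (nth w)
sum≡S []       = refl
sum≡S (x ∷ xs) = trans (cong (λ s → x + s) (sum≡S xs)) (sym (S-front (length xs) (nth (x ∷ xs))))

length-dropLast : ∀ x xs → length (dropLast (x ∷ xs)) ≡ length xs
length-dropLast x []       = refl
length-dropLast x (y ∷ xs) = cong suc (length-dropLast y xs)

nth-dropLast : ∀ w t → suc t < length w → nth (dropLast w) t ≡ nth w t
nth-dropLast (x ∷ [])    zero    (s≤s ())
nth-dropLast (x ∷ y ∷ w) zero    _         = refl
nth-dropLast (x ∷ y ∷ w) (suc t) (s≤s t<) = nth-dropLast (y ∷ w) t t<

dropLast-snoc : ∀ xs y → dropLast (xs ++ y ∷ []) ≡ xs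
dropLast-snoc []            y = refl
dropLast-snoc (x ∷ [])      y = refl
dropLast-snoc (x ∷ x′ ∷ xs) y = cong (x ∷_) (dropLast-snoc (x′ ∷ xs) y)

stepFwd-stepBwd : ∀ x xs → stepFwd (stepBwd (x ∷ xs)) ≡ x ∷ xs
stepFwd-stepBwd x xs = cong₂ _∷_ sum-restored (dropLast-snoc xs (x - sum xs))
  where
  sum-++ : ∀ ys zs → sum (ys ++ zs) ≡ sum ys + sum zs
  sum-++ []       zs = sym (ℤP.+-identityˡ (sum zs))
  sum-++ (y ∷ ys) zs = trans (cong (λ s → y + s) (sum-++ ys zs)) (sym (ℤP.+-assoc y (sum ys) (sum zs)))
  cancel : ∀ a x → a + ((x - a) + 0ℤ) ≡ x
  cancel = solve-∀
  sum-restored : sum (xs ++ (x - sum xs) ∷ []) ≡ x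
  sum-restored = trans (sum-++ xs _) (cancel (sum xs) x)

nth-applyUpTo : ∀ (f : ℕ → ℤ) k t → t < k → nth (applyUpTo f k) t ≡ f t
nth-applyUpTo f (suc k) zero    _         = refl
nth-applyUpTo f (suc k) (suc t) (s≤s t<k) = nth-applyUpTo (f ∘ suc) k t t<k

-- The windows of recSeq (suc k′) init: W n = [x_n, x_{n-1}, …, x_{n-k′}].
module Windows (k′ : ℕ) (init : ℕ → ℤ) where
  k : ℕ
  k = suc k′

  W₀ : List ℤ
  W₀ = map init (upTo k)

  W : ℤ → List ℤ
  W (+ m)    = iter m stepFwd W₀
  W -[1+ m ] = iter (suc m) stepBwd W₀

  x : ℤ → ℤ
  x = recSeq k init

  x≡head : ∀ n → x n ≡ nth (W n) 0
  x≡head (+ m)    = refl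
  x≡head -[1+ m ] = refl

  length-W₀ : length W₀ ≡ k
  length-W₀ = trans (ListP.length-map init (upTo k)) (ListP.length-applyUpTo (λ t → t) k)

  length-W : ∀ n → length (W n) ≡ k
  length-W (+ m) = forward m
    where
    forward : ∀ m → length (iter m stepFwd W₀) ≡ k
    forward zero    = length-W₀
    forward (suc m) with iter m stepFwd W₀ | forward m
    ... | y ∷ ys | len = trans (cong suc (length-dropLast y ys)) len
  length-W -[1+ m ] = backward (suc m)
    where
    backward : ∀ m → length (iter m stepBwd W₀) ≡ k
    backward zero    = length-W₀
    backward (suc m) with iter m stepBwd W₀ | backward m
    ... | y ∷ ys | len = trans (ListP.length-++ ys) (trans (ℕP.+-comm (length ys) 1) len)

  -- Windows have length k ≥ 1, so stepFwd undoes stepBwd on them.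
  restore : ∀ w → length w ≡ k → stepFwd (stepBwd w) ≡ w
  restore (y ∷ ys) _ = stepFwd-stepBwd y ys

  W-next : ∀ n → W (n + + 1) ≡ stepFwd (W n)
  W-next (+ m)         = cong (λ l → iter l stepFwd W₀) (ℕP.+-comm m 1)
  W-next -[1+ zero ]   = sym (restore W₀ length-W₀)
  W-next -[1+ suc m ]  = sym (restore (iter (suc m) stepBwd W₀) (length-W -[1+ m ]))

  nth-W : ∀ t → t < k → ∀ n → nth (W n) t ≡ x (n - + t)
  nth-W zero    _   n = trans (sym (x≡head n)) (cong x (sym (ℤP.+-identityʳ n)))
  nth-W (suc t) t<k n = begin
    nth (W n) (suc t)                      ≡⟨ cong (λ m → nth (W m) (suc t)) (sym (back-forth n)) ⟩
    nth (W (n - + 1 + + 1)) (suc t)        ≡⟨ cong (λ w → nth w (suc t)) (W-next (n - + 1)) ⟩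
    nth (dropLast (W (n - + 1))) t         ≡⟨ nth-dropLast (W (n - + 1)) t (subst (suc t <_) (sym (length-W (n - + 1))) t<k) ⟩
    nth (W (n - + 1)) t                    ≡⟨ nth-W t (ℕP.<-trans (ℕP.n<1+n t) t<k) (n - + 1) ⟩
    x (n - + 1 - + t)                      ≡⟨ cong x (shift n (+ t)) ⟩
    x (n - + suc t)                        ∎
    where
    open ≡-Reasoning
    back-forth : ∀ n → n - + 1 + + 1 ≡ n
    back-forth = solve-∀
    shift : ∀ n t → n - + 1 - t ≡ n - (+ 1 + t)
    shift = solve-∀

  recSeq-rec : Rec k x
  recSeq-rec n = begin
    x (n + + 1)                 ≡⟨ x≡head (n + + 1) ⟩
    nth (W (n + + 1)) 0         ≡⟨ cong (λ w → nth w 0) (W-next n) ⟩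
    sum (W n)                   ≡⟨ sum≡S (W n) ⟩
    S (length (W n)) (nth (W n)) ≡⟨ cong (λ l → S l (nth (W n))) (length-W n) ⟩
    S k (nth (W n))             ≡⟨ S-cong k (λ t t<k → nth-W t t<k n) ⟩
    S k (λ t → x (n - + t))     ∎
    where open ≡-Reasoning

  recSeq-init : ∀ t → t < k → x (- + t) ≡ init t
  recSeq-init t t<k = begin
    x (- + t)        ≡⟨ cong x (sym (ℤP.+-identityˡ (- + t))) ⟩
    x (0ℤ - + t)     ≡⟨ sym (nth-W t t<k 0ℤ) ⟩
    nth W₀ t         ≡⟨ cong (λ w → nth w t) (ListP.map-upTo init k) ⟩
    nth (applyUpTo init k) t ≡⟨ nth-applyUpTo init k t t<k ⟩
    init t           ∎
    where open ≡-Reasoning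

open Windows using (recSeq-rec; recSeq-init) public

Rec-shift : ∀ k x → Rec k x → ∀ c → Rec k (λ n → x (n + c))
Rec-shift k x rec c n =
  trans (cong x (reorder₁ n c)) (trans (rec (n + c)) (S-cong k (λ t _ → cong x (reorder₂ n c (+ t)))))
  where
  reorder₁ : ∀ n c → n + + 1 + c ≡ n + c + + 1
  reorder₁ = solve-∀
  reorder₂ : ∀ n c t → n + c - t ≡ n - t + c
  reorder₂ = solve-∀

Rec-- : ∀ k x y → Rec k x → Rec k y → Rec k (λ n → x n - y n)
Rec-- k x y rec-x rec-y n = trans (cong₂ _-_ (rec-x n) (rec-y n)) (sym (S-- k _ _))

Rec-* : ∀ k c x → Rec k x → Rec k (λ n → c * x n)
Rec-* k c x rec n = trans (cong (c *_) (rec n)) (sym (S-*ˡ k c _))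

Rec-S : ∀ k N (X : ℕ → ℤ → ℤ) → (∀ m → Rec k (X m)) → Rec k (λ n → S N (λ m → X m n))
Rec-S k N X rec n = trans (S-cong N (λ m _ → rec m n)) (S-swap N k (λ m t → X m (n - + t)))

Rec-unfold : ∀ k x → Rec k x → ∀ n → x n ≡ S k (λ t → x (n - + suc t))
Rec-unfold k x rec n = trans (cong x (back-forth n)) (trans (rec (n - + 1)) (S-cong k (λ t _ → cong x (shift n (+ t)))))
  where
  back-forth : ∀ n → n ≡ n - + 1 + + 1
  back-forth = solve-∀
  shift : ∀ n t → n - + 1 - t ≡ n - (+ 1 + t)
  shift = solve-∀

-- Subtracting the recurrence at n - 1 from the one at n gives the two-term form
-- x_{n+1} + x_{n-k} = 2 x_n, which runs the recurrence backwards cheaply.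
Rec-back : ∀ k′ x → Rec (suc k′) x → ∀ n → x (n - + suc k′) ≡ x n + x n - x (n + + 1)
Rec-back k′ x rec n = trans (sym (cancel (x (n + + 1)) _)) (cong (_- x (n + + 1)) two-term)
  where
  open ≡-Reasoning
  cancel : ∀ p q → p + q - p ≡ q
  cancel = solve-∀
  regroup : ∀ a s b → a + s + b ≡ a + (s + b)
  regroup = solve-∀
  two-term : x (n + + 1) + x (n - + suc k′) ≡ x n + x n
  two-term = begin
    x (n + + 1) + x (n - + suc k′)                              ≡⟨ cong (_+ x (n - + suc k′)) (trans (rec n) (S-front k′ _)) ⟩
    x (n - + 0) + S k′ (λ t → x (n - + suc t)) + x (n - + suc k′) ≡⟨ cong (λ a → a + S k′ (λ t → x (n - + suc t)) + x (n - + suc k′)) (cong x (ℤP.+-identityʳ n)) ⟩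
    x n + S k′ (λ t → x (n - + suc t)) + x (n - + suc k′)       ≡⟨ regroup (x n) _ _ ⟩
    x n + S (suc k′) (λ t → x (n - + suc t))                    ≡⟨ cong (λ s → x n + s) (sym (Rec-unfold (suc k′) x rec n)) ⟩
    x n + x n                                                    ∎

Rec-vanish : ∀ k′ x → Rec (suc k′) x → (∀ t → t < suc k′ → x (- + t) ≡ 0ℤ) → ∀ n → x n ≡ 0ℤ
Rec-vanish k′ x rec window n = trans (cong x (sym (ℤP.+-identityʳ n))) (everywhere n 0 (s≤s z≤n))
  where
  k = suc k′
  Zero : ℤ → Set
  Zero a = ∀ t → t < k → x (a - + t) ≡ 0ℤ
  shift : ∀ a t → + 1 + a - (+ 1 + t) ≡ a - t
  shift = solve-∀
  shift′ : ∀ a t → - + 1 + a - t ≡ a - (+ 1 + t)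
  shift′ = solve-∀
  up : ∀ a → Zero a → Zero (+ 1 + a)
  up a zero-a zero    _      = begin
    x (+ 1 + a - + 0)          ≡⟨ cong x (reorder a) ⟩
    x (a + + 1)                ≡⟨ rec a ⟩
    S k (λ t → x (a - + t))    ≡⟨ S-vanish k _ zero-a ⟩
    0ℤ                         ∎
    where
    open ≡-Reasoning
    reorder : ∀ a → + 1 + a - + 0 ≡ a + + 1
    reorder = solve-∀
  up a zero-a (suc t) 1+t<k = trans (cong x (shift a (+ t))) (zero-a t (ℕP.<-trans (ℕP.n<1+n t) 1+t<k))
  down : ∀ a → Zero a → Zero (- + 1 + a)
  down a zero-a t t<k with ℕP.m≤n⇒m<n∨m≡n (ℕP.≤-pred t<k)
  ... | inj₁ t<k′ = trans (cong x (shift′ a (+ t))) (zero-a (suc t) (s≤s t<k′))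
  ... | inj₂ refl = begin
    x (- + 1 + a - + k′)                ≡⟨ cong x (shift′ a (+ k′)) ⟩
    x (a - + k)                         ≡⟨ sym (ℤP.+-identityˡ _) ⟩
    0ℤ + x (a - + k)                    ≡⟨ cong (_+ x (a - + k)) (sym (S-vanish k′ _ (λ t t<k′ → zero-a (suc t) (s≤s t<k′)))) ⟩
    S k (λ t → x (a - + suc t))         ≡⟨ sym (Rec-unfold k x rec a) ⟩
    x a                                 ≡⟨ trans (cong x (sym (ℤP.+-identityʳ a))) (zero-a 0 (s≤s z≤n)) ⟩
    0ℤ                                  ∎
    where open ≡-Reasoning
  zero-at-0 : Zero 0ℤ
  zero-at-0 t t<k = trans (cong x (ℤP.+-identityˡ (- + t))) (window t t<k)
  everywhere : ∀ n → Zero n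
  everywhere (+ zero)       = zero-at-0
  everywhere (+ suc m)      = up (+ m) (everywhere (+ m))
  everywhere -[1+ zero ]    = down 0ℤ zero-at-0
  everywhere -[1+ suc m ]   = down -[1+ m ] (everywhere -[1+ m ])

Rec-unique : ∀ k′ x y → Rec (suc k′) x → Rec (suc k′) y →
             (∀ t → t < suc k′ → x (- + t) ≡ y (- + t)) → ∀ n → x n ≡ y n
Rec-unique k′ x y rec-x rec-y agree n =
  ℤP.i-j≡0⇒i≡j (x n) (y n)
    (Rec-vanish k′ (λ m → x m - y m) (Rec-- (suc k′) x y rec-x rec-y)
      (λ t t<k → trans (cong (_- y (- + t)) (agree t t<k)) (ℤP.+-inverseʳ (y (- + t)))) n)

sift-in : ∀ N (w : ℕ → ℤ) u p → u ≤ p → p < u ℕ.+ N → S N (λ t → w t * δ p (u ℕ.+ t)) ≡ w (p ∸ u)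
sift-in N w u p u≤p p<u+N = trans (S-single N _ (p ∸ u) p∸u<N off) picked
  where
  u+[p∸u]≡p : u ℕ.+ (p ∸ u) ≡ p
  u+[p∸u]≡p = ℕP.m+[n∸m]≡n u≤p
  p∸u<N : p ∸ u < N
  p∸u<N = ℕP.+-cancelˡ-< u (p ∸ u) N (subst (_< u ℕ.+ N) (sym u+[p∸u]≡p) p<u+N)
  off : ∀ t → t < N → t ≢ p ∸ u → w t * δ p (u ℕ.+ t) ≡ 0ℤ
  off t _ t≢ = trans (cong (w t *_) (δ-diff (λ p≡u+t → t≢ (trans (sym (ℕP.m+n∸m≡n u t)) (cong (_∸ u) (sym p≡u+t))))))
                     (ℤP.*-zeroʳ (w t))
  picked : w (p ∸ u) * δ p (u ℕ.+ (p ∸ u)) ≡ w (p ∸ u)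
  picked = trans (cong (λ v → w (p ∸ u) * δ p v) u+[p∸u]≡p)
                 (trans (cong (w (p ∸ u) *_) (δ-same p)) (ℤP.*-identityʳ (w (p ∸ u))))

sift-out : ∀ N (w : ℕ → ℤ) u p → p < u ⊎ u ℕ.+ N ≤ p → S N (λ t → w t * δ p (u ℕ.+ t)) ≡ 0ℤ
sift-out N w u p outside = S-vanish N _ (λ t t<N → trans (cong (w t *_) (δ-diff (off t t<N))) (ℤP.*-zeroʳ (w t)))
  where
  off : ∀ t → t < N → p ≢ u ℕ.+ t
  off t t<N p≡u+t =
    [ (λ p<u → ℕP.<⇒≱ p<u (subst (u ≤_) (sym p≡u+t) (ℕP.m≤m+n u t)))
    , (λ u+N≤p → ℕP.<⇒≱ (ℕP.+-monoʳ-< u t<N) (subst (u ℕ.+ N ≤_) p≡u+t u+N≤p)) ]′ outside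

-- A solution of order k = j + 2 whose initial window (x_0, …, x_{1-k}) is constant c
-- except for the value a at 1 - k keeps the value c on [2 - 2k, -k-1]; only x_{-k}
-- deviates.  So on [2 - 2k, 0] it is c plus two deltas ("shape"), which makes sums
-- of its values over such ranges computable by sifting (profile-sum).
module Profile (j : ℕ) (x : ℤ → ℤ) (rec : Rec (suc (suc j)) x) (c a : ℤ)
               (window-c : ∀ v → v < suc j → x (- + v) ≡ c) (window-a : x (- + suc j) ≡ a) where

  -- the value forced at -k
  b : ℤ
  b = c + c - (+ suc j * c + a)

  shape : ℕ → ℤ
  shape v = c + δ (suc j) v * (a - c) + δ (suc (suc j)) v * (b - c)

  shape-c : ∀ v → suc j ≢ v → suc (suc j) ≢ v → shape v ≡ c
  shape-c v k′≢v k≢v = trans (cong₂ (λ d₁ d₂ → c + d₁ * (a - c) + d₂ * (b - c)) (δ-diff k′≢v) (δ-diff k≢v))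
                             (only-c c (a - c) (b - c))
    where
    only-c : ∀ c A B → c + 0ℤ * A + 0ℤ * B ≡ c
    only-c = solve-∀

  shape-a : shape (suc j) ≡ a
  shape-a = trans (cong₂ (λ d₁ d₂ → c + d₁ * (a - c) + d₂ * (b - c)) (δ-same (suc j)) (δ-diff {suc (suc j)} {suc j} ℕP.1+n≢n))
                  (only-a c a (b - c))
    where
    only-a : ∀ c a B → c + + 1 * (a - c) + 0ℤ * B ≡ a
    only-a = solve-∀

  shape-b : shape (suc (suc j)) ≡ b
  shape-b = trans (cong₂ (λ d₁ d₂ → c + d₁ * (a - c) + d₂ * (b - c)) (δ-diff {suc j} {suc (suc j)} (ℕP.1+n≢n ∘ sym)) (δ-same (suc (suc j))))
                  (only-b c (a - c) b)
    where
    only-b : ∀ c A b → c + 0ℤ * A + + 1 * (b - c) ≡ b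
    only-b = solve-∀

  -- the recurrence at 0 and its backward form at 0 determine x_{-k}
  at-k : x (- + suc (suc j)) ≡ b
  at-k = begin
    x (- + suc (suc j))                           ≡⟨ cong x (sym (ℤP.+-identityˡ _)) ⟩
    x (0ℤ - + suc (suc j))                        ≡⟨ Rec-back (suc j) x rec 0ℤ ⟩
    x 0ℤ + x 0ℤ - x (0ℤ + + 1)                    ≡⟨ cong₂ (λ y z → y + y - z) (window-c 0 (s≤s z≤n)) (rec 0ℤ) ⟩
    c + c - S (suc (suc j)) (λ t → x (0ℤ - + t))  ≡⟨ cong (λ s → c + c - (s + x (0ℤ - + suc j))) window-sum ⟩
    c + c - (+ suc j * c + x (- + suc j))         ≡⟨ cong (λ y → c + c - (+ suc j * c + y)) window-a ⟩
    b                                             ∎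
    where
    open ≡-Reasoning
    window-sum : S (suc j) (λ t → x (0ℤ - + t)) ≡ + suc j * c
    window-sum = trans (S-cong (suc j) (λ t t<k′ → trans (cong x (ℤP.+-identityˡ _)) (window-c t t<k′)))
                       (S-const (suc j) c)

  -- the backward form at -1-s, s < j, gives x_{-k-1-s} = 2c - c
  beyond-k : ∀ s → s < j → x (- + (suc (suc j) ℕ.+ suc s)) ≡ c
  beyond-k s s<j = begin
    x (- + (suc (suc j) ℕ.+ suc s))          ≡⟨ cong x (reindex (+ s) (+ j)) ⟩
    x (n - + suc (suc j))                    ≡⟨ Rec-back (suc j) x rec n ⟩
    x n + x n - x (n + + 1)                  ≡⟨ cong₂ (λ y z → y + y - z) (window-c (suc s) (s≤s s<j))
                                                  (trans (cong x (reorder (+ s))) (window-c s (ℕP.<-trans s<j (ℕP.n<1+n j)))) ⟩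
    c + c - c                                ≡⟨ cancel c ⟩
    c                                        ∎
    where
    open ≡-Reasoning
    n = - + suc s
    reindex : ∀ s j → - (+ 1 + (+ 1 + j) + (+ 1 + s)) ≡ - (+ 1 + s) - (+ 1 + (+ 1 + j))
    reindex = solve-∀
    reorder : ∀ s → - (+ 1 + s) + + 1 ≡ - s
    reorder = solve-∀
    cancel : ∀ c → c + c - c ≡ c
    cancel = solve-∀

  profile : ∀ v → v ≤ suc j ℕ.+ suc j → x (- + v) ≡ shape v
  profile v v≤ with ℕP.<-cmp v (suc j)
  ... | tri< v<k′ _ _ = trans (window-c v v<k′) (sym (shape-c v (λ k′≡v → ℕP.<-irrefl (sym k′≡v) v<k′)
                                                      (λ k≡v → ℕP.<-irrefl (sym k≡v) (ℕP.<-trans v<k′ (ℕP.n<1+n (suc j))))))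
  ... | tri≈ _ refl _ = trans window-a (sym shape-a)
  ... | tri> _ _ k′<v = subst (λ w → x (- + w) ≡ shape w) (ℕP.m+[n∸m]≡n k′<v)
                              (past-k′ (v ∸ suc (suc j)) (subst (_≤ suc j ℕ.+ suc j) (sym (ℕP.m+[n∸m]≡n k′<v)) v≤))
    where
    past-k′ : ∀ d → suc (suc j) ℕ.+ d ≤ suc j ℕ.+ suc j → x (- + (suc (suc j) ℕ.+ d)) ≡ shape (suc (suc j) ℕ.+ d)
    past-k′ zero    _     = subst (λ w → x (- + w) ≡ shape w) (sym (ℕP.+-identityʳ _)) (trans at-k (sym shape-b))
    past-k′ (suc s) bound = trans (beyond-k s s<j)
      (sym (shape-c _ (ℕP.m≢1+m+n (suc j)) (λ k≡ → ℕP.m≢1+m+n (suc (suc j)) (trans k≡ (ℕP.+-suc (suc (suc j)) s)))))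
      where
      s<j : s < j
      s<j = ℕP.≤-pred (ℕP.+-cancelˡ-≤ (suc j) _ _ (subst (_≤ suc j ℕ.+ suc j) (sym (ℕP.+-suc (suc j) (suc s))) bound))

  profile-sum : ∀ N (w : ℕ → ℤ) u → u ℕ.+ N ≤ suc (suc j ℕ.+ suc j) →
                S N (λ t → w t * x (- + (u ℕ.+ t)))
                  ≡ S N w * c + S N (λ t → w t * δ (suc j) (u ℕ.+ t)) * (a - c)
                              + S N (λ t → w t * δ (suc (suc j)) (u ℕ.+ t)) * (b - c)
  profile-sum N w u in-range = begin
    S N (λ t → w t * x (- + (u ℕ.+ t)))
      ≡⟨ S-cong N (λ t t<N → trans (cong (w t *_) (profile (u ℕ.+ t) (bound t t<N))) (distribute (w t) _ _)) ⟩
    S N (λ t → w t * c + w t * δ (suc j) (u ℕ.+ t) * (a - c) + w t * δ (suc (suc j)) (u ℕ.+ t) * (b - c))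
      ≡⟨ trans (S-+ N _ _) (cong (_+ S N (λ t → w t * δ (suc (suc j)) (u ℕ.+ t) * (b - c))) (S-+ N _ _)) ⟩
    S N (λ t → w t * c) + S N (λ t → w t * δ (suc j) (u ℕ.+ t) * (a - c))
                        + S N (λ t → w t * δ (suc (suc j)) (u ℕ.+ t) * (b - c))
      ≡⟨ cong₂ _+_ (cong₂ _+_ (S-*ʳ N c w) (S-*ʳ N (a - c) _)) (S-*ʳ N (b - c) _) ⟩
    S N w * c + S N (λ t → w t * δ (suc j) (u ℕ.+ t)) * (a - c)
              + S N (λ t → w t * δ (suc (suc j)) (u ℕ.+ t)) * (b - c)
      ∎
    where
    open ≡-Reasoning
    bound : ∀ t → t < N → u ℕ.+ t ≤ suc j ℕ.+ suc j
    bound t t<N = ℕP.≤-pred (ℕP.<-≤-trans (ℕP.+-monoʳ-< u t<N) in-range)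
    distribute : ∀ w d₁ d₂ → w * (c + d₁ * (a - c) + d₂ * (b - c)) ≡ w * c + w * d₁ * (a - c) + w * d₂ * (b - c)
    distribute w d₁ d₂ = lemma w d₁ d₂ c a b
      where
      lemma : ∀ w d₁ d₂ c a b → w * (c + d₁ * (a - c) + d₂ * (b - c)) ≡ w * c + w * d₁ * (a - c) + w * d₂ * (b - c)
      lemma = solve-∀

≤ᵇ-true : ∀ {m n} → m ≤ n → (m ≤ᵇ n) ≡ true
≤ᵇ-true m≤n = Equivalence.to T-≡ (ℕP.≤⇒≤ᵇ m≤n)

≤ᵇ-false : ∀ {m n} → n < m → (m ≤ᵇ n) ≡ false
≤ᵇ-false {m} {n} n<m = ¬-not (λ m≤ᵇn → ℕP.<⇒≱ n<m (ℕP.≤ᵇ⇒≤ m n (Equivalence.from T-≡ m≤ᵇn)))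

≡ᵇ-true : ∀ {m n} → m ≡ n → (m ≡ᵇ n) ≡ true
≡ᵇ-true {m} {n} m≡n = Equivalence.to T-≡ (ℕP.≡⇒≡ᵇ m n m≡n)

≡ᵇ-false : ∀ {m n} → m ≢ n → (m ≡ᵇ n) ≡ false
≡ᵇ-false {m} {n} m≢n = ¬-not (λ m≡ᵇn → m≢n (ℕP.≡ᵇ⇒≡ m n (Equivalence.from T-≡ m≡ᵇn)))

-- The three regimes of the initial values l^i_{k,-u} (at n = -u one has i - n = i + u).
lucInit-below : ∀ k i u → i ℕ.+ u < k → lucInit k i u ≡ - + i
lucInit-below k i u i+u<k rewrite ≤ᵇ-true i+u<k = refl

lucInit-at : ∀ k i u → i ℕ.+ u ≡ k → lucInit k i u ≡ + (i ℕ.+ 2 ℕ.* u)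
lucInit-at k i u i+u≡k rewrite ≤ᵇ-false (ℕP.≤-reflexive (cong suc (sym i+u≡k))) | ≡ᵇ-true i+u≡k = refl

lucInit-above : ∀ k i u → k < i ℕ.+ u → lucInit k i u ≡ + k - + i - + 1
lucInit-above k i u k<i+u rewrite ≤ᵇ-false (ℕP.<-trans k<i+u (ℕP.n<1+n _)) | ≡ᵇ-false (λ i+u≡k → ℕP.<-irrefl (sym i+u≡k) k<i+u) = refl

-- For i ≤ k the three cases defining d_j merge into d_j = T(min(j,k)) - T(j - i),
-- with T the triangular numbers and j - i truncated at 0.
dcoef-closed : ∀ k i J → i ≤ k → dcoef k i J ≡ + tri (J ⊓ k) - + tri (J ∸ i)
dcoef-closed k i J i≤k with J ≤ᵇ i in J≤ᵇi
... | true = sym (trans (cong₂ (λ m l → + tri m - + tri l) (ℕP.m≤n⇒m⊓n≡m (ℕP.≤-trans J≤i i≤k)) (ℕP.m≤n⇒m∸n≡0 J≤i))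
                        (ℤP.+-identityʳ (+ tri J)))
  where
  J≤i : J ≤ i
  J≤i = ℕP.≤ᵇ⇒≤ J i (subst T (sym J≤ᵇi) _)
... | false with J ≤ᵇ k ∸ 1 in J≤ᵇk-1
...   | true  = cong (λ m → + tri m - + tri (J ∸ i)) (sym (ℕP.m≤n⇒m⊓n≡m J≤k))
  where
  J≤k : J ≤ k
  J≤k = ℕP.≤-trans (ℕP.≤ᵇ⇒≤ J (k ∸ 1) (subst T (sym J≤ᵇk-1) _)) (ℕP.m∸n≤m k 1)
...   | false = cong (λ m → + tri m - + tri (J ∸ i)) (sym (ℕP.m≥n⇒m⊓n≡n k≤J))
  where
  k≤J : k ≤ J
  k≤J = ℕP.≤-trans (ℕP.m≤n+m∸n k 1) (ℕP.≰⇒> (λ J≤k-1 → subst T J≤ᵇk-1 (ℕP.≤⇒≤ᵇ J≤k-1)))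

dcoef-step : ∀ k i J → i < k → dcoef k (suc i) J - dcoef k i J ≡ + tri (J ∸ i) - + tri (J ∸ suc i)
dcoef-step k i J i<k =
  trans (cong₂ _-_ (dcoef-closed k (suc i) J i<k) (dcoef-closed k i J (ℕP.<⇒≤ i<k)))
        (regroup (+ tri (J ⊓ k)) (+ tri (J ∸ suc i)) (+ tri (J ∸ i)))
  where
  regroup : ∀ A B C → A - B - (A - C) ≡ C - B
  regroup = solve-∀

tri-step : ∀ m → + tri (suc m) - + tri m ≡ + suc m
tri-step m = trans (cong (_- + tri m) (ℤP.pos-+ (tri m) (suc m))) (cancel (+ tri m) (+ suc m))
  where
  cancel : ∀ a b → a + b - a ≡ b
  cancel = solve-∀

double : ∀ n → + (2 ℕ.* n) ≡ + n + + n
double n = trans (cong (λ m → + (n ℕ.+ m)) (ℕP.+-identityʳ n)) (ℤP.pos-+ n n)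

pos-∸ : ∀ {m n} → n ≤ m → + (m ∸ n) ≡ + m - + n
pos-∸ {m} {n} n≤m = trans (sym (ℤP.⊖-≥ n≤m)) (sym (ℤP.[+m]-[+n]≡m⊖n m n))

-- From here on the order is fixed: k = j + 2 ≥ 2.  F = f^k_k and L i = l^i_k.
module Lucas (j : ℕ) where
  k : ℕ
  k = suc (suc j)

  F : ℤ → ℤ
  F = fib k k

  F-rec : Rec k F
  F-rec = recSeq-rec (suc j) (fibInit k k)

  F-window : ∀ v → v < k → F (- + v) ≡ δ (suc j) v
  F-window = recSeq-init (suc j) (fibInit k k)

  -- f^k_{k,-v} on [0, 2k-2]: 0, except 1 at v = k - 1 and -1 at v = k
  module F-shape = Profile j F F-rec 0ℤ (+ 1)
    (λ v v<k′ → trans (F-window v (ℕP.<-trans v<k′ (ℕP.n<1+n _))) (δ-diff (λ k′≡v → ℕP.<-irrefl (sym k′≡v) v<k′)))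
    (trans (F-window (suc j) ℕP.≤-refl) (δ-same (suc j)))

  -- H n = k f_n - Σ_{j=2}^{k} (k-j+1) f_{n+1-j}, the right side of (ii) for i = 1
  w : ℕ → ℤ
  w t = + (j ∸ t ℕ.+ 1)

  H : ℤ → ℤ
  H n = + k * F n - S (suc j) (λ t → w t * F (n - + suc t))

  -- H is a linear combination of shifts of F
  H-rec : Rec k H
  H-rec = Rec-- k (λ n → + k * F n) (λ n → S (suc j) (λ t → w t * F (n - + suc t)))
            (Rec-* k (+ k) F F-rec)
            (Rec-S k (suc j) (λ t n → w t * F (n - + suc t))
              (λ t → Rec-* k (w t) (λ n → F (n - + suc t)) (Rec-shift k F F-rec (- + suc t))))

  -- the two deltas of the profile of f^k (values 1 at 1-k and -1 at -k), seen
  -- through the sum in H (-u)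
  Δ₁ Δ₂ : ℕ → ℤ
  Δ₁ u = S (suc j) (λ t → w t * δ (suc j) (suc u ℕ.+ t))
  Δ₂ u = S (suc j) (λ t → w t * δ k (suc u ℕ.+ t))

  H-profile : ∀ u → u ≤ suc j → H (- + u) ≡ + k * F (- + u) - (Δ₁ u - Δ₂ u)
  H-profile u u≤k′ = cong (λ s → + k * F (- + u) - s) (begin
    S (suc j) (λ t → w t * F (- + u - + suc t))
      ≡⟨ S-cong (suc j) (λ t _ → cong (λ m → w t * F m) (reindex (+ u) (+ t))) ⟩
    S (suc j) (λ t → w t * F (- + (suc u ℕ.+ t)))
      ≡⟨ F-shape.profile-sum (suc j) w (suc u) (s≤s (ℕP.+-monoˡ-≤ (suc j) u≤k′)) ⟩
    S (suc j) w * 0ℤ + Δ₁ u * (+ 1 - 0ℤ) + Δ₂ u * (F-shape.b - 0ℤ)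
      ≡⟨ simplify (S (suc j) w) (Δ₁ u) (Δ₂ u) (+ suc j) ⟩
    Δ₁ u - Δ₂ u ∎)
    where
    open ≡-Reasoning
    reindex : ∀ u t → - u - (+ 1 + t) ≡ - (+ 1 + (u + t))
    reindex = solve-∀
    simplify : ∀ W D₁ D₂ J → W * 0ℤ + D₁ * (+ 1 - 0ℤ) + D₂ * ((0ℤ + 0ℤ - (J * 0ℤ + + 1)) - 0ℤ) ≡ D₁ - D₂
    simplify = solve-∀

  -- the weight of H picked out by the delta at 1-k when H is evaluated at -u
  weight-at : ∀ u → u ≤ j → w (j ∸ u) ≡ + suc u
  weight-at u u≤j = cong +_ (trans (cong (ℕ._+ 1) (ℕP.m∸[m∸n]≡n u≤j)) (ℕP.+-comm u 1))

  Δ₁-value : ∀ u → u ≤ j → Δ₁ u ≡ + suc u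
  Δ₁-value u u≤j = trans (sift-in (suc j) w (suc u) (suc j) (s≤s u≤j) (s≤s (ℕP.m≤n+m (suc j) u))) (weight-at u u≤j)

  Δ₂-value : ∀ u → u ≤ suc j → Δ₂ u ≡ + u
  Δ₂-value zero    _         = sift-out (suc j) w 1 k (inj₂ ℕP.≤-refl)
  Δ₂-value (suc u) (s≤s u≤j) =
    trans (sift-in (suc j) w (suc (suc u)) k (s≤s (s≤s u≤j)) (s≤s (s≤s (ℕP.m≤n+m (suc j) u))))
          (weight-at u u≤j)

  H-window : ∀ u → u < k → H (- + u) ≡ lucInit k 1 u
  H-window u u<k with ℕP.m≤n⇒m<n∨m≡n (ℕP.≤-pred u<k)
  ... | inj₁ (s≤s u≤j) = begin
    H (- + u)                        ≡⟨ H-profile u (ℕP.m≤n⇒m≤1+n u≤j) ⟩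
    + k * F (- + u) - (Δ₁ u - Δ₂ u)  ≡⟨ cong₂ (λ f d → + k * f - d) F-zero
                                              (cong₂ _-_ (Δ₁-value u u≤j) (Δ₂-value u (ℕP.m≤n⇒m≤1+n u≤j))) ⟩
    + k * 0ℤ - (+ suc u - + u)       ≡⟨ collapse (+ k) (+ u) ⟩
    - + 1                            ≡⟨ sym (lucInit-below k 1 u (s≤s (s≤s u≤j))) ⟩
    lucInit k 1 u                    ∎
    where
    open ≡-Reasoning
    F-zero : F (- + u) ≡ 0ℤ
    F-zero = trans (F-window u (s≤s (ℕP.m≤n⇒m≤1+n u≤j))) (δ-diff (λ k′≡u → ℕP.<-irrefl (sym k′≡u) (s≤s u≤j)))
    collapse : ∀ K u → K * 0ℤ - ((+ 1 + u) - u) ≡ - + 1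
    collapse = solve-∀
  ... | inj₂ refl = begin
    H (- + suc j)                                    ≡⟨ H-profile (suc j) ℕP.≤-refl ⟩
    + k * F (- + suc j) - (Δ₁ (suc j) - Δ₂ (suc j))  ≡⟨ cong₂ (λ f d → + k * f - d)
                                                              (trans (F-window (suc j) ℕP.≤-refl) (δ-same (suc j)))
                                                              (cong₂ _-_ (sift-out (suc j) w (suc (suc j)) (suc j) (inj₁ ℕP.≤-refl))
                                                                         (Δ₂-value (suc j) ℕP.≤-refl)) ⟩
    + k * + 1 - (0ℤ - + suc j)                       ≡⟨ collapse (+ suc j) ⟩
    + 1 + (+ suc j + + suc j)                        ≡⟨ cong (λ m → + 1 + m) (sym (double (suc j))) ⟩
    + (1 ℕ.+ 2 ℕ.* suc j)                            ≡⟨ sym (lucInit-at k 1 (suc j) refl) ⟩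
    lucInit k 1 (suc j)                              ∎
    where
    open ≡-Reasoning
    collapse : ∀ J → (+ 1 + J) * + 1 - (0ℤ - J) ≡ + 1 + (J + J)
    collapse = solve-∀

  L : ℕ → ℤ → ℤ
  L i = lucas k i

  L-rec : ∀ i → Rec k (L i)
  L-rec i = recSeq-rec (suc j) (lucInit k i)

  L-window : ∀ i u → u < k → L i (- + u) ≡ lucInit k i u
  L-window i = recSeq-init (suc j) (lucInit k i)

  -- (ii) for i = 1: both sides solve the recurrence and share the initial window
  L1≡H : ∀ n → L 1 n ≡ H n
  L1≡H = Rec-unique (suc j) (L 1) H (L-rec 1) H-rec (λ u u<k → trans (L-window 1 u u<k) (sym (H-window u u<k)))

  module L1-shape = Profile j (L 1) (L-rec 1) (- + 1) (+ 1 + (+ suc j + + suc j))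
    (λ v v<k′ → trans (L-window 1 v (ℕP.<-trans v<k′ (ℕP.n<1+n _))) (lucInit-below k 1 v (s≤s v<k′)))
    (trans (L-window 1 (suc j) ℕP.≤-refl)
           (trans (lucInit-at k 1 (suc j) refl) (cong (λ m → + 1 + m) (double (suc j)))))

  -- the two deltas of the profile of l^1 (excess 2k at 1-k and -(k+1) at -k), seen
  -- through a block sum of length i starting at -u
  E₁ E₂ : ℕ → ℕ → ℤ
  E₁ i u = S i (λ t → + 1 * δ (suc j) (u ℕ.+ t))
  E₂ i u = S i (λ t → + 1 * δ k (u ℕ.+ t))

  block-profile : ∀ i u → i ≤ k → u < k →
                  S i (λ m → L 1 (- + u - + m)) ≡ - + i + E₁ i u * (+ k + + k) - E₂ i u * (+ k + + 1)
  block-profile i u i≤k u<k = begin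
    S i (λ m → L 1 (- + u - + m))
      ≡⟨ S-cong i (λ m _ → trans (cong (L 1) (reindex (+ u) (+ m))) (sym (ℤP.*-identityˡ _))) ⟩
    S i (λ m → + 1 * L 1 (- + (u ℕ.+ m)))
      ≡⟨ L1-shape.profile-sum i (λ _ → + 1) u in-range ⟩
    S i (λ _ → + 1) * - + 1 + E₁ i u * ((+ 1 + (+ suc j + + suc j)) - - + 1) + E₂ i u * (L1-shape.b - - + 1)
      ≡⟨ cong (λ s → s * - + 1 + E₁ i u * ((+ 1 + (+ suc j + + suc j)) - - + 1) + E₂ i u * (L1-shape.b - - + 1)) (S-const i (+ 1)) ⟩
    + i * + 1 * - + 1 + E₁ i u * ((+ 1 + (+ suc j + + suc j)) - - + 1) + E₂ i u * (L1-shape.b - - + 1)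
      ≡⟨ simplify (+ i) (+ suc j) (E₁ i u) (E₂ i u) ⟩
    - + i + E₁ i u * (+ k + + k) - E₂ i u * (+ k + + 1) ∎
    where
    open ≡-Reasoning
    reindex : ∀ u m → - u - m ≡ - (u + m)
    reindex = solve-∀
    in-range : u ℕ.+ i ≤ suc (suc j ℕ.+ suc j)
    in-range = ℕP.≤-trans (ℕP.+-mono-≤ (ℕP.≤-pred u<k) i≤k) (ℕP.≤-reflexive (ℕP.+-suc (suc j) (suc j)))
    simplify : ∀ I J E₁ E₂ →
               I * + 1 * - + 1 + E₁ * ((+ 1 + (J + J)) - - + 1) + E₂ * ((- + 1 + - + 1 - (J * - + 1 + (+ 1 + (J + J)))) - - + 1)
               ≡ - I + E₁ * ((+ 1 + J) + (+ 1 + J)) - E₂ * ((+ 1 + J) + + 1)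
    simplify = solve-∀

  -- The window of n ↦ Σ_{m<i} l^1_{k,n-m} is that of l^i_k: the three regimes of
  -- lucInit are the three positions of the block [u, u+i) relative to k-1 and k.
  block-window : ∀ i u → i ≤ k → u < k → S i (λ m → L 1 (- + u - + m)) ≡ lucInit k i u
  block-window i u i≤k u<k = trans (block-profile i u i≤k u<k) (regimes (ℕP.<-cmp (i ℕ.+ u) k))
    where
    open ≡-Reasoning
    one : ℕ → ℤ
    one _ = + 1
    u≤k′ : u ≤ suc j
    u≤k′ = ℕP.≤-pred u<k
    regimes : Tri (i ℕ.+ u < k) (i ℕ.+ u ≡ k) (k < i ℕ.+ u) →
              - + i + E₁ i u * (+ k + + k) - E₂ i u * (+ k + + 1) ≡ lucInit k i u
    regimes (tri< i+u<k _ _) = begin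
      - + i + E₁ i u * (+ k + + k) - E₂ i u * (+ k + + 1)
        ≡⟨ cong₂ (λ e₁ e₂ → - + i + e₁ * (+ k + + k) - e₂ * (+ k + + 1))
                 (sift-out i one u (suc j) (inj₂ u+i≤k′)) (sift-out i one u k (inj₂ (ℕP.m≤n⇒m≤1+n u+i≤k′))) ⟩
      - + i + 0ℤ * (+ k + + k) - 0ℤ * (+ k + + 1)   ≡⟨ neither (+ i) (+ k) ⟩
      - + i                                         ≡⟨ sym (lucInit-below k i u i+u<k) ⟩
      lucInit k i u                                 ∎
      where
      u+i≤k′ : u ℕ.+ i ≤ suc j
      u+i≤k′ = subst (_≤ suc j) (ℕP.+-comm i u) (ℕP.≤-pred i+u<k)
      neither : ∀ I K → - I + 0ℤ * (K + K) - 0ℤ * (K + + 1) ≡ - I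
      neither = solve-∀
    regimes (tri≈ _ i+u≡k _) = begin
      - + i + E₁ i u * (+ k + + k) - E₂ i u * (+ k + + 1)
        ≡⟨ cong₂ (λ e₁ e₂ → - + i + e₁ * (+ k + + k) - e₂ * (+ k + + 1))
                 (sift-in i one u (suc j) u≤k′ (subst (suc j <_) (sym u+i≡k) ℕP.≤-refl))
                 (sift-out i one u k (inj₂ (ℕP.≤-reflexive u+i≡k))) ⟩
      - + i + + 1 * (+ k + + k) - 0ℤ * (+ k + + 1)
        ≡⟨ cong (λ K → - + i + + 1 * (K + K) - 0ℤ * (K + + 1)) k≡i+u ⟩
      - + i + + 1 * ((+ i + + u) + (+ i + + u)) - 0ℤ * ((+ i + + u) + + 1)
        ≡⟨ first-only (+ i) (+ u) ⟩
      + i + (+ u + + u)                             ≡⟨ cong (λ m → + i + m) (sym (double u)) ⟩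
      + (i ℕ.+ 2 ℕ.* u)                             ≡⟨ sym (lucInit-at k i u i+u≡k) ⟩
      lucInit k i u                                 ∎
      where
      u+i≡k : u ℕ.+ i ≡ k
      u+i≡k = trans (ℕP.+-comm u i) i+u≡k
      k≡i+u : + k ≡ + i + + u
      k≡i+u = trans (cong +_ (sym i+u≡k)) (ℤP.pos-+ i u)
      first-only : ∀ I U → - I + + 1 * ((I + U) + (I + U)) - 0ℤ * ((I + U) + + 1) ≡ I + (U + U)
      first-only = solve-∀
    regimes (tri> _ _ k<i+u) = begin
      - + i + E₁ i u * (+ k + + k) - E₂ i u * (+ k + + 1)
        ≡⟨ cong₂ (λ e₁ e₂ → - + i + e₁ * (+ k + + k) - e₂ * (+ k + + 1))
                 (sift-in i one u (suc j) u≤k′ (ℕP.<-trans (ℕP.n<1+n (suc j)) k<u+i))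
                 (sift-in i one u k (ℕP.m≤n⇒m≤1+n u≤k′) k<u+i) ⟩
      - + i + + 1 * (+ k + + k) - + 1 * (+ k + + 1) ≡⟨ both (+ i) (+ k) ⟩
      + k - + i - + 1                               ≡⟨ sym (lucInit-above k i u k<i+u) ⟩
      lucInit k i u                                 ∎
      where
      k<u+i : k < u ℕ.+ i
      k<u+i = subst (k <_) (ℕP.+-comm i u) k<i+u
      both : ∀ I K → - I + + 1 * (K + K) - + 1 * (K + + 1) ≡ K - I - + 1
      both = solve-∀

  L-sum : ∀ i → i ≤ k → ∀ n → L i n ≡ S i (λ m → L 1 (n - + m))
  L-sum i i≤k = Rec-unique (suc j) (L i) (λ n → S i (λ m → L 1 (n - + m))) (L-rec i)
    (Rec-S k i (λ m n → L 1 (n - + m)) (λ m → Rec-shift k (L 1) (L-rec 1) (- + m)))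
    (λ u u<k → trans (L-window i u u<k) (sym (block-window i u i≤k u<k)))

  L-last : ∀ n → L k n ≡ L 1 (n + + 1)
  L-last n = trans (L-sum k ℕP.≤-refl n) (sym (L-rec 1 n))

  -- G n = Σ_{j=1}^{k} j f_{n-j}, the right side of (iii) for i = 1
  G : ℤ → ℤ
  G n = S k (λ t → + suc t * F (n - + suc t))

  -- Unfolding f_n in k f_n turns H into G: the weights k - (k - 1 - t) are 1 + t.
  G≡H : ∀ n → G n ≡ H n
  G≡H n = sym (begin
    H n
      ≡⟨ cong (λ y → + k * y - S (suc j) (λ t → w t * f t)) (Rec-unfold k F F-rec n) ⟩
    + k * S k f - S (suc j) (λ t → w t * f t)
      ≡⟨ cong (_- S (suc j) (λ t → w t * f t)) (sym (S-*ˡ k (+ k) f)) ⟩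
    S (suc j) (λ t → + k * f t) + + k * f (suc j) - S (suc j) (λ t → w t * f t)
      ≡⟨ move-last (S (suc j) (λ t → + k * f t)) (+ k * f (suc j)) _ ⟩
    S (suc j) (λ t → + k * f t) - S (suc j) (λ t → w t * f t) + + k * f (suc j)
      ≡⟨ cong (_+ + k * f (suc j)) (sym (S-- (suc j) _ _)) ⟩
    S (suc j) (λ t → + k * f t - w t * f t) + + k * f (suc j)
      ≡⟨ cong (_+ + k * f (suc j)) (S-cong (suc j) (λ t t<k′ → complement t (ℕP.≤-pred t<k′))) ⟩
    G n ∎)
    where
    open ≡-Reasoning
    f : ℕ → ℤ
    f t = F (n - + suc t)
    move-last : ∀ a b c → a + b - c ≡ a - c + b
    move-last = solve-∀
    complement : ∀ t → t ≤ j → + k * f t - w t * f t ≡ + suc t * f t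
    complement t t≤j = trans (cong (λ d → + k * f t - (d + + 1) * f t) (pos-∸ t≤j)) (weights (+ j) (+ t) (f t))
      where
      weights : ∀ J T y → (+ 1 + (+ 1 + J)) * y - ((J - T) + + 1) * y ≡ (+ 1 + T) * y
      weights = solve-∀

  L1≡G : ∀ n → L 1 n ≡ G n
  L1≡G n = trans (L1≡H n) (sym (G≡H n))

  -- Dsum i a = Σ_{J=1}^{k+i-1} d_J f_{a-J}, the right side of (i)
  Dsum : ℕ → ℤ → ℤ
  Dsum i a = S (suc j ℕ.+ i) (λ t → dcoef k i (suc t) * F (a - + suc t))

  Dsum-zero : ∀ a → Dsum 0 a ≡ 0ℤ
  Dsum-zero a = S-vanish (suc j ℕ.+ 0) _ (λ t t< → trans (cong (_* F (a - + suc t)) (no-weight t t<)) (ℤP.*-zeroˡ (F (a - + suc t))))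
    where
    no-weight : ∀ t → t < suc j ℕ.+ 0 → dcoef k 0 (suc t) ≡ 0ℤ
    no-weight t t< = trans (dcoef-closed k 0 (suc t) z≤n)
      (trans (cong (λ m → + tri m - + tri (suc t)) (ℕP.m≤n⇒m⊓n≡m 1+t≤k)) (ℤP.+-inverseʳ (+ tri (suc t))))
      where
      1+t≤k : suc t ≤ k
      1+t≤k = ℕP.m≤n⇒m≤1+n (subst (suc t ≤_) (ℕP.+-identityʳ (suc j)) t<)

  -- Passing from i to i + 1 adds one copy of G: the new weights exceed the old ones
  -- by T(J - i) - T(J - i - 1), which is 0 for J ≤ i and J - i for i < J ≤ i + k.
  Dsum-step : ∀ i → i < k → ∀ a → Dsum (suc i) a ≡ Dsum i a + G (a - + i)
  Dsum-step i i<k a = begin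
    Dsum (suc i) a
      ≡⟨ cong (λ l → S l (λ t → d₁ t * f t)) range ⟩
    S (i ℕ.+ k) (λ t → d₁ t * f t)
      ≡⟨ S-difference (i ℕ.+ k) _ _ ⟩
    S (i ℕ.+ k) (λ t → d₀ t * f t) + S (i ℕ.+ k) (λ t → d₁ t * f t - d₀ t * f t)
      ≡⟨ cong₂ _+_ Dsum-extended increment ⟩
    Dsum i a + G (a - + i) ∎
    where
    open ≡-Reasoning
    d₀ d₁ f : ℕ → ℤ
    d₀ t = dcoef k i (suc t)
    d₁ t = dcoef k (suc i) (suc t)
    f t = F (a - + suc t)
    range : suc j ℕ.+ suc i ≡ i ℕ.+ k
    range = trans (ℕP.+-suc (suc j) i) (ℕP.+-comm k i)
    factor : ∀ x y z → x * z - y * z ≡ (x - y) * z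
    factor = solve-∀
    -- the summand J = k + i of Dsum i a has weight T(k) - T(k) = 0
    Dsum-extended : S (i ℕ.+ k) (λ t → d₀ t * f t) ≡ Dsum i a
    Dsum-extended = begin
      S (i ℕ.+ k) (λ t → d₀ t * f t)
        ≡⟨ cong (λ l → S l (λ t → d₀ t * f t)) (ℕP.+-comm i k) ⟩
      Dsum i a + d₀ (suc j ℕ.+ i) * f (suc j ℕ.+ i)
        ≡⟨ cong (λ d → Dsum i a + d * f (suc j ℕ.+ i)) last-weight ⟩
      Dsum i a + 0ℤ * f (suc j ℕ.+ i)
        ≡⟨ trans (cong (λ y → Dsum i a + y) (ℤP.*-zeroˡ (f (suc j ℕ.+ i)))) (ℤP.+-identityʳ (Dsum i a)) ⟩
      Dsum i a ∎
      where
      last-weight : dcoef k i (k ℕ.+ i) ≡ 0ℤ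
      last-weight = trans (dcoef-closed k i (k ℕ.+ i) (ℕP.<⇒≤ i<k))
        (trans (cong₂ (λ m l → + tri m - + tri l) (ℕP.m≥n⇒m⊓n≡n (ℕP.m≤m+n k i)) (ℕP.m+n∸n≡m k i))
               (ℤP.+-inverseʳ (+ tri k)))
    increment : S (i ℕ.+ k) (λ t → d₁ t * f t - d₀ t * f t) ≡ G (a - + i)
    increment = begin
      S (i ℕ.+ k) (λ t → d₁ t * f t - d₀ t * f t)
        ≡⟨ S-split i k _ ⟩
      S i (λ t → d₁ t * f t - d₀ t * f t) + S k (λ s → d₁ (i ℕ.+ s) * f (i ℕ.+ s) - d₀ (i ℕ.+ s) * f (i ℕ.+ s))
        ≡⟨ cong₂ _+_ (S-vanish i _ (λ t t<i → trans (factor (d₁ t) (d₀ t) (f t)) (low t t<i)))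
                     (S-cong k (λ s _ → trans (factor (d₁ (i ℕ.+ s)) (d₀ (i ℕ.+ s)) (f (i ℕ.+ s))) (high s))) ⟩
      0ℤ + G (a - + i)
        ≡⟨ ℤP.+-identityˡ _ ⟩
      G (a - + i) ∎
      where
      low : ∀ t → t < i → (d₁ t - d₀ t) * f t ≡ 0ℤ
      low t t<i = trans (cong (_* f t) (trans (dcoef-step k i (suc t) i<k)
                    (cong₂ (λ m l → + tri m - + tri l) (ℕP.m≤n⇒m∸n≡0 t<i) (ℕP.m≤n⇒m∸n≡0 (ℕP.m≤n⇒m≤1+n t<i)))))
                    (ℤP.*-zeroˡ (f t))
      high : ∀ s → (d₁ (i ℕ.+ s) - d₀ (i ℕ.+ s)) * f (i ℕ.+ s) ≡ + suc s * F (a - + i - + suc s)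
      high s = cong₂ _*_
        (trans (dcoef-step k i (suc (i ℕ.+ s)) i<k)
               (trans (cong (λ m → + tri m - + tri (i ℕ.+ s ∸ i))
                            (trans (cong (_∸ i) (sym (ℕP.+-suc i s))) (ℕP.m+n∸m≡n i (suc s))))
                      (trans (cong (λ m → + tri (suc s) - + tri m) (ℕP.m+n∸m≡n i s)) (tri-step s))))
        (cong F (reindex a (+ i) (+ s)))
        where
        reindex : ∀ a i s → a - (+ 1 + (i + s)) ≡ a - i - (+ 1 + s)
        reindex = solve-∀

  Dsum≡ΣG : ∀ i → i ≤ k → ∀ a → Dsum i a ≡ S i (λ m → G (a - + m))
  Dsum≡ΣG zero    _   a = Dsum-zero a
  Dsum≡ΣG (suc i) i<k a = trans (Dsum-step i i<k a) (cong (_+ G (a - + i)) (Dsum≡ΣG i (ℕP.<⇒≤ i<k) a))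

  H-∑ : ∀ a → H a ≡ + k * F a - ∑ 2 k (λ J → + (k ∸ J ℕ.+ 1) * F (a + + 1 - + J))
  H-∑ a = cong (λ s → + k * F a - s)
    (sym (trans (∑≡S 2 k (λ J → + (k ∸ J ℕ.+ 1) * F (a + + 1 - + J))) (S-cong (suc j) (λ t _ → cong (λ m → w t * F m) (reindex a (+ t))))))
    where
    reindex : ∀ a t → a + + 1 - (+ 1 + (+ 1 + t)) ≡ a - (+ 1 + t)
    reindex = solve-∀

  G-∑ : ∀ a → G a ≡ ∑ 1 k (λ J → + J * F (a - + J))
  G-∑ a = sym (∑≡S 1 k (λ J → + J * F (a - + J)))

  -- (i), for 1 ≤ i ≤ k (the statement asks k ≥ 3; the argument works for k ≥ 2)
  formula-i : ∀ i n → i ≤ k → L i (+ n) ≡ ∑ 1 (k ℕ.+ i ∸ 1) (λ J → dcoef k i J * F (+ n - + J))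
  formula-i i n i≤k = begin
    L i (+ n)                     ≡⟨ L-sum i i≤k (+ n) ⟩
    S i (λ m → L 1 (+ n - + m))  ≡⟨ S-cong i (λ m _ → L1≡G (+ n - + m)) ⟩
    S i (λ m → G (+ n - + m))    ≡⟨ sym (Dsum≡ΣG i i≤k (+ n)) ⟩
    Dsum i (+ n)                  ≡⟨ sym (∑≡S 1 (k ℕ.+ i ∸ 1) (λ J → dcoef k i J * F (+ n - + J))) ⟩
    ∑ 1 (k ℕ.+ i ∸ 1) (λ J → dcoef k i J * F (+ n - + J)) ∎
    where open ≡-Reasoning

  -- (ii): the case 1 < i < k is L-sum with every term given by L1≡H
  formula-ii-first : ∀ a → L 1 a ≡ + k * F a - ∑ 2 k (λ J → + (k ∸ J ℕ.+ 1) * F (a + + 1 - + J))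
  formula-ii-first a = trans (L1≡H a) (H-∑ a)

  formula-ii-middle : ∀ i n → i ≤ k →
    L i (+ n) ≡ ∑ 1 i (λ m → + k * F (+ n - + m + + 1))
                - ∑ 1 i (λ m → ∑ 2 k (λ J → + (k ∸ J ℕ.+ 1) * F (+ n - + m - + J + + 2)))
  formula-ii-middle i n i≤k = begin
    L i (+ n)
      ≡⟨ L-sum i i≤k (+ n) ⟩
    S i (λ m → L 1 (+ n - + m))
      ≡⟨ S-cong i (λ m _ → trans (L1≡H (+ n - + m)) (H-∑ (+ n - + m))) ⟩
    S i (λ m → + k * F (+ n - + m) - ∑ 2 k (tail m))
      ≡⟨ S-- i (λ m → + k * F (+ n - + m)) (λ m → ∑ 2 k (tail m)) ⟩
    S i (λ m → + k * F (+ n - + m)) - S i (λ m → ∑ 2 k (tail m))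
      ≡⟨ cong₂ _-_
           (sym (trans (∑≡S 1 i head′) (S-cong i (λ m _ → cong (λ y → + k * F y) (reindex₁ (+ n) (+ m))))))
           (sym (trans (∑≡S 1 i (λ m → ∑ 2 k (tail′ m))) (S-cong i (λ m _ → ∑-cong 2 k (tail′ (suc m)) (tail m) (λ t _ →
                  cong (λ y → + (k ∸ (2 ℕ.+ t) ℕ.+ 1) * F y) (reindex₂ (+ n) (+ m) (+ t))))))) ⟩
    ∑ 1 i head′ - ∑ 1 i (λ m → ∑ 2 k (tail′ m)) ∎
    where
    open ≡-Reasoning
    tail tail′ : ℕ → ℕ → ℤ
    tail  m J = + (k ∸ J ℕ.+ 1) * F (+ n - + m + + 1 - + J)
    tail′ m J = + (k ∸ J ℕ.+ 1) * F (+ n - + m - + J + + 2)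
    head′ : ℕ → ℤ
    head′ m = + k * F (+ n - + m + + 1)
    reindex₁ : ∀ n m → n - (+ 1 + m) + + 1 ≡ n - m
    reindex₁ = solve-∀
    reindex₂ : ∀ n m t → n - (+ 1 + m) - (+ 1 + (+ 1 + t)) + + 2 ≡ n - m + + 1 - (+ 1 + (+ 1 + t))
    reindex₂ = solve-∀

  formula-ii-last : ∀ n → L k (+ n) ≡ + k * F (+ n + + 1) - ∑ 2 k (λ J → + (k ∸ J ℕ.+ 1) * F (+ n + + 2 - + J))
  formula-ii-last n =
    trans (L-last (+ n)) (trans (formula-ii-first (+ n + + 1))
      (cong (λ s → + k * F (+ n + + 1) - s)
            (∑-cong 2 k (λ J → + (k ∸ J ℕ.+ 1) * F (+ n + + 1 + + 1 - + J)) (λ J → + (k ∸ J ℕ.+ 1) * F (+ n + + 2 - + J))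
                        (λ t _ → cong (λ y → + (k ∸ (2 ℕ.+ t) ℕ.+ 1) * F (y - + (2 ℕ.+ t))) (ℤP.+-assoc (+ n) (+ 1) (+ 1))))))

  formula-iii-first : ∀ a → L 1 a ≡ ∑ 1 k (λ J → + J * F (a - + J))
  formula-iii-first a = trans (L1≡G a) (G-∑ a)

  formula-iii-middle : ∀ i n → i ≤ k → L i (+ n) ≡ ∑ 1 i (λ m → ∑ 1 k (λ J → + J * F (+ n - + m - + J + + 1)))
  formula-iii-middle i n i≤k = begin
    L i (+ n)
      ≡⟨ L-sum i i≤k (+ n) ⟩
    S i (λ m → L 1 (+ n - + m))
      ≡⟨ S-cong i (λ m _ → trans (L1≡G (+ n - + m)) (trans (G-∑ (+ n - + m))
           (∑-cong 1 k (λ J → + J * F (+ n - + m - + J)) (λ J → + J * F (+ n - + suc m - + J + + 1))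
                       (λ t _ → cong (λ y → + suc t * F y) (reindex (+ n) (+ m) (+ t)))))) ⟩
    S i (λ m → ∑ 1 k (λ J → + J * F (+ n - + suc m - + J + + 1)))
      ≡⟨ sym (∑≡S 1 i (λ m → ∑ 1 k (λ J → + J * F (+ n - + m - + J + + 1)))) ⟩
    ∑ 1 i (λ m → ∑ 1 k (λ J → + J * F (+ n - + m - + J + + 1))) ∎
    where
    open ≡-Reasoning
    reindex : ∀ n m t → n - m - (+ 1 + t) ≡ n - (+ 1 + m) - (+ 1 + t) + + 1
    reindex = solve-∀

  formula-iii-last : ∀ n → L k (+ n) ≡ ∑ 1 k (λ J → + J * F (+ n + + 1 - + J))
  formula-iii-last n = trans (L-last (+ n)) (formula-iii-first (+ n + + 1))

part-i : (k i n : ℕ) → 3 ≤ k → 1 ≤ i → i ≤ k →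
  lucas k i (+ n) ≡ ∑ 1 (k Data.Nat.+ i ∸ 1) (λ j → dcoef k i j * fib k k (+ n - + j))
part-i (suc zero) _ _ (s≤s ()) _ _
part-i (suc (suc j)) i n _ _ i≤k = Lucas.formula-i j i n i≤k

part-ii : (k i n : ℕ) → 2 ≤ k → 1 ≤ i → i ≤ k →
  (i ≡ 1 →
    lucas k i (+ n) ≡ + k * fib k k (+ n)
                      - ∑ 2 k (λ j → + (k ∸ j Data.Nat.+ 1) * fib k k (+ n + + 1 - + j)))
  × (1 < i → i < k →
    lucas k i (+ n) ≡ ∑ 1 i (λ m → + k * fib k k (+ n - + m + + 1))
                      - ∑ 1 i (λ m → ∑ 2 k (λ j →
                          + (k ∸ j Data.Nat.+ 1) * fib k k (+ n - + m - + j + + 2))))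
  × (i ≡ k →
    lucas k i (+ n) ≡ + k * fib k k (+ n + + 1)
                      - ∑ 2 k (λ j → + (k ∸ j Data.Nat.+ 1) * fib k k (+ n + + 2 - + j)))
part-ii (suc zero) _ _ (s≤s ()) _ _
part-ii (suc (suc j)) i n _ _ i≤k =
  (λ { refl → formula-ii-first (+ n) }) , (λ _ _ → formula-ii-middle i n i≤k) , (λ { refl → formula-ii-last n })
  where open Lucas j

part-iii : (k i n : ℕ) → 2 ≤ k → 1 ≤ i → i ≤ k →
  (i ≡ 1 →
    lucas k i (+ n) ≡ ∑ 1 k (λ j → + j * fib k k (+ n - + j)))
  × (1 < i → i < k →
    lucas k i (+ n) ≡ ∑ 1 i (λ m → ∑ 1 k (λ j → + j * fib k k (+ n - + m - + j + + 1))))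
  × (i ≡ k →
    lucas k i (+ n) ≡ ∑ 1 k (λ j → + j * fib k k (+ n + + 1 - + j)))
part-iii (suc zero) _ _ (s≤s ()) _ _
part-iii (suc (suc j)) i n _ _ i≤k =
  (λ { refl → formula-iii-first (+ n) }) , (λ _ _ → formula-iii-middle i n i≤k) , (λ { refl → formula-iii-last n })
  where open Lucas j

theorem2p10 :
    ((k i n : ℕ) → 3 ≤ k → 1 ≤ i → i ≤ k →
      lucas k i (+ n) ≡ ∑ 1 (k Data.Nat.+ i ∸ 1) (λ j → dcoef k i j * fib k k (+ n - + j)))
    × ((k i n : ℕ) → 2 ≤ k → 1 ≤ i → i ≤ k →
      (i ≡ 1 →
        lucas k i (+ n) ≡ + k * fib k k (+ n)
                          - ∑ 2 k (λ j → + (k ∸ j Data.Nat.+ 1) * fib k k (+ n + + 1 - + j)))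
      × (1 < i → i < k →
        lucas k i (+ n) ≡ ∑ 1 i (λ m → + k * fib k k (+ n - + m + + 1))
                          - ∑ 1 i (λ m → ∑ 2 k (λ j →
                              + (k ∸ j Data.Nat.+ 1) * fib k k (+ n - + m - + j + + 2))))
      × (i ≡ k →
        lucas k i (+ n) ≡ + k * fib k k (+ n + + 1)
                          - ∑ 2 k (λ j → + (k ∸ j Data.Nat.+ 1) * fib k k (+ n + + 2 - + j))))
    × ((k i n : ℕ) → 2 ≤ k → 1 ≤ i → i ≤ k →
      (i ≡ 1 →
        lucas k i (+ n) ≡ ∑ 1 k (λ j → + j * fib k k (+ n - + j)))
      × (1 < i → i < k →
        lucas k i (+ n) ≡ ∑ 1 i (λ m → ∑ 1 k (λ j → + j * fib k k (+ n - + m - + j + + 1))))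
      × (i ≡ k →
        lucas k i (+ n) ≡ ∑ 1 k (λ j → + j * fib k k (+ n + + 1 - + j))))
theorem2p10 = part-i , part-ii , part-iii
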